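{- Let $G$ be a connected graph of order $n$ with maximum degree $\Delta(G)$. If $G$ has at least two cut vertices and $n-4\le \Delta(G)\le n-2$, then $vcfc(G)=3$.
   Context: Vertex-colorings are arbitrary, not necessarily proper. A path in a vertex-colored graph is called conflict-free if there is a color used on exactly one of its vertices. A vertex-colored graph is conflict-free vertex-connected if any two vertices of the graph are connected by a conflict-free path. For a connected graph $G$, the conflict-free vertex-connection number $vcfc(G)$ is the smallest number of colors needed in a vertex-coloring of $G$ that makes $G$ conflict-free vertex-connected. -}

module Defs where

open import Data.Nat using (ℕ; zero; suc; _≤_; _⊔_)
open import Data.Fin using (Fin)
open import Data.Fin.Properties using (_≟_)
open import Data.Bool using (Bool; true; false)
open import Data.List using (List; []; _∷_; length; filter; map; foldr)
open import Data.List.Relation.Unary.All using (All)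
open import Data.List.Relation.Unary.Unique.Propositional using (Unique)
open import Data.Product using (Σ; _×_; ∃; ∃-syntax; _,_)
open import Relation.Binary.PropositionalEquality using (_≡_; _≢_)
open import Relation.Nullary using (¬_)
open import Data.List using (allFin)
open import Relation.Nullary.Decidable using (does)

record Graph (n : ℕ) : Set where
  field
    Adj   : Fin n → Fin n → Bool
    sym   : ∀ u v → Adj u v ≡ Adj v u
    irrefl : ∀ v → Adj v v ≡ false
open Graph public

module _ {n : ℕ} (G : Graph n) where

  data Walk : Fin n → Fin n → Set where
    [_]  : ∀ v → Walk v v
    step : ∀ {u w v} → Adj G u w ≡ true → Walk w v → Walk u v

  vertices : ∀ {u v} → Walk u v → List (Fin n)
  vertices [ v ] = v ∷ []
  vertices (step {u} _ w) = u ∷ vertices w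

  IsPath : ∀ {u v} → Walk u v → Set
  IsPath w = Unique (vertices w)

  Connected : Set
  Connected = ∀ u v → Walk u v

  IsCutVertex : Fin n → Set
  IsCutVertex v = ∃[ a ] ∃[ b ] (a ≢ v × b ≢ v ×
      ¬ (Σ (Walk a b) λ w → All (λ x → x ≢ v) (vertices w)))

  degree : Fin n → ℕ
  degree v = length (filter (λ u → Adj G v u ≟b true) (allFin n))
    where
      open import Data.Bool.Properties renaming (_≟_ to _≟b_)

  maxDegree : ℕ
  maxDegree = foldr _⊔_ 0 (map degree (allFin n))

  countColour : {k : ℕ} → (Fin n → Fin k) → Fin k → List (Fin n) → ℕ
  countColour c i vs = length (filter (λ x → c x ≟ i) vs)

  ConflictFree : {k : ℕ} → (Fin n → Fin k) → ∀ {u v} → Walk u v → Set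
  ConflictFree {k} c w = ∃[ i ] countColour c i (vertices w) ≡ 1

  CFVConnected : {k : ℕ} → (Fin n → Fin k) → Set
  CFVConnected c = ∀ u v → Σ (Walk u v) λ w → IsPath w × ConflictFree c w

  VcfcIs : ℕ → Set
  VcfcIs m = (Σ (Fin n → Fin m) CFVConnected)
           × (∀ k (c : Fin n → Fin k) → CFVConnected c → m ≤ k)

module Submission where

-- If x and y are distinct cut vertices, there are vertices a beyond x (cut off
-- from y by x) and b beyond y, and every a–b path passes through both x and y.  Walking from
-- a towards x along a conflict-free path, one may move a so that a and x get different colours,
-- and likewise for b and y.  With only two colours, the colour used once on an a–b path then
-- occurs on one of a, x and on one of b, y: twice.
--
-- Let v have maximum degree.  As Δ ≥ n − 4, at most three vertices are neither v
-- nor adjacent to v, and by connectivity each lies at distance 2, 3 or 4 from v.  A breadth-first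
-- tree on v, these vertices, their chosen common neighbours with v and one further neighbour of v
-- has one of finitely many shapes.  Colour v and its neighbours 0 and 1, vertices at depth 2, 3, 4
-- with 2, (0 or 1, depending on the shape) and 0: evaluating all shapes shows that every tree
-- path is conflict-free.  Tree paths are paths of G, and two further neighbours of v are joined
-- through v.

open import Defs hiding (sym)
open import Data.Nat using (ℕ; zero; suc; pred; _+_; _⊔_; _≤_; _<_; z≤n; s≤s; _≤?_)
open import Data.Nat.Properties
  using (n≤1+n; m≤n⇒m≤1+n; ≤-refl; ≤-reflexive; ≤-trans; ≤-total; ≤-pred; ≰⇒>; suc-injective;
         ⊔-lub; ⊔-identityʳ; +-suc; +-cancelˡ-≤; +-monoˡ-≤; module ≤-Reasoning)
import Data.Nat.Properties as ℕₚ
open import Data.Fin using (Fin; zero; suc)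
open import Data.Fin.Properties using (_≟_; any?; all?; injective⇒≤)
open import Data.Bool using (Bool; true; false; if_then_else_)
import Data.Bool.Properties as Boolₚ
open import Data.Maybe using (fromMaybe)
open import Data.List
  using (List; []; _∷_; _++_; length; map; filter; foldr; reverse; head; takeWhile; drop; allFin; tabulate;
         cartesianProductWith)
import Data.List as List
open import Data.List.Properties
  using (length-tabulate; map-∘; map-id-local; filter-none; filter-accept; filter-reject)
open import Data.List.Relation.Unary.All using (All; []; _∷_)
import Data.List.Relation.Unary.All as All
open import Data.List.Relation.Unary.All.Properties using (¬Any⇒All¬)
open import Data.List.Relation.Unary.Any using (here; there; index)
import Data.List.Relation.Unary.Any as Any
open import Data.List.Relation.Unary.Any.Properties using (lookup-index)
open import Data.List.Relation.Unary.AllPairs using ([]; _∷_; allPairs?)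
open import Data.List.Relation.Unary.Unique.Propositional using (Unique)
open import Data.List.Relation.Unary.Unique.Propositional.Properties using (filter⁺; allFin⁺)
import Data.List.Relation.Unary.Unique.Propositional.Properties as Unique
open import Data.List.Membership.Propositional using (_∈_; find)
open import Data.List.Membership.Propositional.Properties
  using (∈-allFin; ∈-lookup; ∈-filter⁺; ∈-filter⁻; ∈-++⁺ˡ; ∈-++⁺ʳ; ∈-map⁺; ∈-cartesianProductWith⁺)
open import Data.Vec using (Vec; []; _∷_; lookup)
import Data.Vec as Vec
open import Data.Vec.Properties using (lookup∘tabulate)
open import Data.Product using (Σ; ∃; ∃-syntax; _×_; _,_; proj₁; proj₂)
open import Data.Sum using (_⊎_; inj₁; inj₂)
open import Data.Unit using (⊤; tt)
open import Data.Empty using (⊥; ⊥-elim)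
open import Function using (id; _∘_)
open import Relation.Binary.Definitions using (DecidableEquality)
open import Relation.Binary.PropositionalEquality
  using (_≡_; _≢_; refl; sym; trans; cong; subst; subst₂; ≢-sym; module ≡-Reasoning)
open import Relation.Nullary using (¬_; Dec; yes; no; does; ¬?; _×-dec_; _⊎-dec_; _→-dec_; contradiction)
open import Relation.Nullary.Decidable using (toWitness; map′; decidable-stable)
open import Relation.Unary using (Decidable)

lookup-injective : ∀ {A : Set} (xs : List A) → Unique xs →
                   ∀ {i j} → List.lookup xs i ≡ List.lookup xs j → i ≡ j
lookup-injective (x ∷ xs) _ {zero} {zero} _ = refl
lookup-injective (x ∷ xs) (x∉ ∷ _) {zero} {suc j} x≡ = contradiction x≡ (All.lookup x∉ (∈-lookup j))
lookup-injective (x ∷ xs) (x∉ ∷ _) {suc i} {zero} ≡x = contradiction (sym ≡x) (All.lookup x∉ (∈-lookup i))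
lookup-injective (x ∷ xs) (_ ∷ u) {suc i} {suc j} eq = cong suc (lookup-injective xs u eq)

unique⇒length≤ : ∀ {k} (xs : List (Fin k)) → Unique xs → length xs ≤ k
unique⇒length≤ xs u = injective⇒≤ (lookup-injective xs u)

Fin≤2-cover : ∀ {k} → k ≤ 2 → ∀ {j l} (i : Fin k) → j ≢ l → i ≡ j ⊎ i ≡ l
Fin≤2-cover k≤2 {j} {l} i j≢l with i ≟ j | i ≟ l
... | yes i≡j | _ = inj₁ i≡j
... | no _ | yes i≡l = inj₂ i≡l
... | no i≢j | no i≢l = contradiction (≤-trans three k≤2) λ { (s≤s (s≤s ())) }
  where
    three = unique⇒length≤ (i ∷ j ∷ l ∷ []) ((i≢j ∷ i≢l ∷ []) ∷ (j≢l ∷ []) ∷ [] ∷ [])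

length-filter-map : ∀ {A B : Set} {P : B → Set} (P? : Decidable P) (g : A → B) xs →
                    length (filter (P? ∘ g) xs) ≡ length (filter P? (map g xs))
length-filter-map P? g [] = refl
length-filter-map P? g (x ∷ xs) with P? (g x)
... | yes _ = cong suc (length-filter-map P? g xs)
... | no _ = length-filter-map P? g xs

module _ {A : Set} {P Q : A → Set} (P? : Decidable P) (Q? : Decidable Q)
         (disjoint : ∀ {x} → P x → ¬ Q x) where

  private
    size : List A → ℕ
    size xs = length (filter P? xs) + length (filter Q? xs)

  length-filter-disjoint-∷ : ∀ x xs → size (x ∷ xs) ≤ suc (size xs)
  length-filter-disjoint-∷ x xs with P? x | Q? x
  ... | yes px | yes qx = contradiction qx (disjoint px)
  ... | yes _ | no _ = ≤-refl
  ... | no _ | yes _ = ≤-reflexive (+-suc _ _)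
  ... | no _ | no _ = n≤1+n _

  length-filter-disjoint : ∀ xs → size xs ≤ length xs
  length-filter-disjoint [] = z≤n
  length-filter-disjoint (x ∷ xs) = ≤-trans (length-filter-disjoint-∷ x xs) (s≤s (length-filter-disjoint xs))

  length-filter-disjoint-< : ∀ {x} xs → x ∈ xs → ¬ P x → ¬ Q x → size xs < length xs
  length-filter-disjoint-< {x} (x ∷ xs) (here refl) ¬px ¬qx with P? x | Q? x
  ... | yes px | _ = contradiction px ¬px
  ... | no _ | yes qx = contradiction qx ¬qx
  ... | no _ | no _ = s≤s (length-filter-disjoint xs)
  length-filter-disjoint-< (y ∷ xs) (there x∈) ¬px ¬qx =
    ≤-trans (s≤s (length-filter-disjoint-∷ y xs)) (s≤s (length-filter-disjoint-< xs x∈ ¬px ¬qx))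

foldr-⊔-attained : ∀ {A : Set} (f : A → ℕ) x xs → ∃[ y ] foldr _⊔_ 0 (map f (x ∷ xs)) ≤ f y
foldr-⊔-attained f x [] = x , ≤-reflexive (⊔-identityʳ (f x))
foldr-⊔-attained f x (x′ ∷ xs) with foldr-⊔-attained f x′ xs
... | y , max≤fy with ≤-total (f x) (f y)
...   | inj₁ fx≤fy = y , ⊔-lub fx≤fy max≤fy
...   | inj₂ fy≤fx = x , ⊔-lub ≤-refl (≤-trans max≤fy fy≤fx)

module WalkProperties {n : ℕ} (G : Graph n) where

  open import Data.List.Membership.DecPropositional (_≟_ {n}) using (_∈?_)

  adj-sym : ∀ {u w} → Adj G u w ≡ true → Adj G w u ≡ true
  adj-sym {u} {w} = trans (Graph.sym G w u)

  infixr 5 _++ʷ_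
  _++ʷ_ : ∀ {a b c} → Walk G a b → Walk G b c → Walk G a c
  [ _ ] ++ʷ w = w
  step e w₁ ++ʷ w₂ = step e (w₁ ++ʷ w₂)

  All-++ʷ : ∀ {P : Fin n → Set} {a b c} (w₁ : Walk G a b) {w₂ : Walk G b c} →
            All P (vertices G w₁) → All P (vertices G w₂) → All P (vertices G (w₁ ++ʷ w₂))
  All-++ʷ [ _ ] _ p₂ = p₂
  All-++ʷ (step _ w₁) (p ∷ p₁) p₂ = p ∷ All-++ʷ w₁ p₁ p₂

  source∈ : ∀ {a b} (w : Walk G a b) → a ∈ vertices G w
  source∈ [ _ ] = here refl
  source∈ (step _ _) = here refl

  target∈ : ∀ {a b} (w : Walk G a b) → b ∈ vertices G w
  target∈ [ _ ] = here refl
  target∈ (step _ w) = there (target∈ w)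

  reverseʷ : ∀ {a b} → Walk G a b → Walk G b a
  reverseʷ [ v ] = [ v ]
  reverseʷ (step {u} e w) = reverseʷ w ++ʷ step (adj-sym e) [ u ]

  All-reverseʷ : ∀ {P : Fin n → Set} {a b} (w : Walk G a b) →
                 All P (vertices G w) → All P (vertices G (reverseʷ w))
  All-reverseʷ [ _ ] p = p
  All-reverseʷ (step _ w) (p ∷ ps) =
    All-++ʷ (reverseʷ w) (All-reverseʷ w ps) (All.lookup ps (source∈ w) ∷ p ∷ [])

  closed-along-walk : ∀ {U : Fin n → Set} → (∀ {z z′} → U z → Adj G z z′ ≡ true → U z′) →
                      ∀ {a b} → Walk G a b → U a → U b
  closed-along-walk closed [ _ ] ua = ua
  closed-along-walk closed (step e w) ua = closed-along-walk closed w (closed ua e)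

  cast-walk : ∀ {a a′ b b′} → a ≡ a′ → b ≡ b′ → (w : Walk G a b) →
              Σ (Walk G a′ b′) λ w′ → vertices G w′ ≡ vertices G w
  cast-walk refl refl w = w , refl

  Avoiding : Fin n → Fin n → Fin n → Set
  Avoiding x a b = Σ (Walk G a b) λ w → All (_≢ x) (vertices G w)

  avoiding-trans : ∀ {x a b c} → Avoiding x a b → Avoiding x b c → Avoiding x a c
  avoiding-trans (w₁ , p₁) (w₂ , p₂) = w₁ ++ʷ w₂ , All-++ʷ w₁ p₁ p₂

  avoiding-sym : ∀ {x a b} → Avoiding x a b → Avoiding x b a
  avoiding-sym (w , p) = reverseʷ w , All-reverseʷ w p

  must-visit : ∀ {x a b} → ¬ Avoiding x a b → (w : Walk G a b) → x ∈ vertices G w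
  must-visit {x} ¬avoid w with x ∈? vertices G w
  ... | yes x∈ = x∈
  ... | no x∉ = contradiction (w , All.map ≢-sym (¬Any⇒All¬ _ x∉)) ¬avoid

  path-prefix : ∀ {s t z} (w : Walk G s t) → Unique (vertices G w) →
                z ∈ vertices G w → z ≢ t → Avoiding t s z
  path-prefix [ _ ] _ (here refl) z≢t = contradiction refl z≢t
  path-prefix (step {s} _ w) (s∉ ∷ _) (here refl) _ = [ s ] , (λ { refl → All.lookup s∉ (target∈ w) refl }) ∷ []
  path-prefix (step {s} e w) (s∉ ∷ u) (there z∈) z≢t with path-prefix w u z∈ z≢t
  ... | w′ , p = step e w′ , (λ { refl → All.lookup s∉ (target∈ w) refl }) ∷ p

  first-entry : ∀ {Q : Fin n → Set} → Decidable Q → ∀ {a b} → Walk G a b → Q b →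
                ∃[ c ] Q c × Σ (Walk G a c) λ w → All (λ z → ¬ Q z ⊎ z ≡ c) (vertices G w)
  first-entry Q? [ b ] qb = b , qb , [ b ] , inj₂ refl ∷ []
  first-entry Q? {a} (step e w) qb with Q? a
  ... | yes qa = a , qa , [ a ] , inj₂ refl ∷ []
  ... | no ¬qa with first-entry Q? w qb
  ...   | c , qc , w′ , p = c , qc , step e w′ , inj₁ ¬qa ∷ p

module ColourCounting {n k : ℕ} (G : Graph n) (c : Fin n → Fin k) where

  countColour-≥1 : ∀ {i p} xs → p ∈ xs → c p ≡ i → 1 ≤ countColour G c i xs
  countColour-≥1 {i} (x ∷ xs) p∈ cp with c x ≟ i
  ... | yes _ = s≤s z≤n
  countColour-≥1 (x ∷ xs) (here refl) cp | no cx≢i = contradiction cp cx≢i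
  countColour-≥1 (x ∷ xs) (there p∈) cp | no _ = countColour-≥1 xs p∈ cp

  countColour-≥2 : ∀ {i p q} xs → p ∈ xs → q ∈ xs → p ≢ q → c p ≡ i → c q ≡ i →
                   2 ≤ countColour G c i xs
  countColour-≥2 {i} (x ∷ xs) p∈ q∈ p≢q cp cq with c x ≟ i
  countColour-≥2 (x ∷ xs) (here refl) (here refl) p≢q _ _ | _ = contradiction refl p≢q
  countColour-≥2 (x ∷ xs) (here refl) (there q∈) _ _ cq | yes _ = s≤s (countColour-≥1 xs q∈ cq)
  countColour-≥2 (x ∷ xs) (there p∈) (here refl) _ cp _ | yes _ = s≤s (countColour-≥1 xs p∈ cp)
  countColour-≥2 (x ∷ xs) (there p∈) (there q∈) p≢q cp cq | yes _ =
    m≤n⇒m≤1+n (countColour-≥2 xs p∈ q∈ p≢q cp cq)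
  countColour-≥2 (x ∷ xs) (here refl) _ _ cp _ | no cx≢i = contradiction cp cx≢i
  countColour-≥2 (x ∷ xs) (there _) (here refl) _ _ cq | no cx≢i = contradiction cq cx≢i
  countColour-≥2 (x ∷ xs) (there p∈) (there q∈) p≢q cp cq | no _ = countColour-≥2 xs p∈ q∈ p≢q cp cq

  countColour-monochrome : ∀ {i j} xs → All (λ z → c z ≡ j) xs → i ≢ j → countColour G c i xs ≡ 0
  countColour-monochrome xs cs i≢j =
    cong length (filter-none _ (All.map (λ cz≡j cz≡i → i≢j (trans (sym cz≡i) cz≡j)) cs))

  once⇒¬twice : ∀ {i p q} xs → countColour G c i xs ≡ 1 →
                p ∈ xs → q ∈ xs → p ≢ q → c p ≡ i → c q ≢ i
  once⇒¬twice xs once p∈ q∈ p≢q cp cq =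
    contradiction (subst (2 ≤_) once (countColour-≥2 xs p∈ q∈ p≢q cp cq)) λ { (s≤s ()) }

module LowerBound {n : ℕ} (G : Graph n) (connected : Connected G) where

  open WalkProperties G

  Beyond : Fin n → Fin n → Fin n → Set
  Beyond x y a = a ≢ x × ¬ Avoiding x a y

  -- Only doubly negated, since reachability in G − x is not decided.
  cutVertex-beyond : ∀ {x} y → IsCutVertex G x → ¬ ¬ ∃ (Beyond x y)
  cutVertex-beyond y (p , q , p≢x , q≢x , ¬pq) ¬beyond =
    ¬beyond (p , p≢x , λ py → ¬beyond (q , q≢x , λ qy → ¬pq (avoiding-trans py (avoiding-sym qy))))

  beyond-separated : ∀ {x y a b} → x ≢ y → Beyond x y a → Beyond y x b → ¬ Avoiding x a b
  beyond-separated {x} {y} {b = b} x≢y (_ , ¬ay) (_ , ¬bx) ab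
    with first-entry (λ z → z ≟ x ⊎-dec z ≟ y) (connected b x) (inj₁ refl)
  ... | _ , inj₁ refl , w , before =
    ¬bx (w , All.map (λ { (inj₁ ¬q) refl → ¬q (inj₂ refl) ; (inj₂ refl) → x≢y }) before)
  ... | _ , inj₂ refl , w , before =
    ¬ay (avoiding-trans ab (w , All.map (λ { (inj₁ ¬q) refl → ¬q (inj₁ refl) ; (inj₂ refl) → ≢-sym x≢y })
                                        before))

  module _ {k : ℕ} (c : Fin n → Fin k) (cfc : CFVConnected G c) where

    open ColourCounting G c

    monochrome⇒¬conflictFree : ∀ {s t} (w : Walk G s t) → s ≢ t →
                               All (λ z → c z ≡ c t) (vertices G w) → ¬ ConflictFree G c w
    monochrome⇒¬conflictFree {t = t} w s≢t mono (i , once) with i ≟ c t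
    ... | yes refl = once⇒¬twice _ once (source∈ w) (target∈ w) s≢t (All.lookup mono (source∈ w)) refl
    ... | no i≢ct = contradiction (trans (sym (countColour-monochrome _ mono i≢ct)) once) λ ()

    conflictFree⇒colour≢ : ∀ {s t} (w : Walk G s t) → ConflictFree G c w → s ≢ t →
                           ∃[ z ] z ∈ vertices G w × c z ≢ c t
    conflictFree⇒colour≢ {t = t} w cf s≢t with Any.any? (λ z → ¬? (c z ≟ c t)) (vertices G w)
    ... | yes some = find some
    ... | no none = contradiction cf
      (monochrome⇒¬conflictFree w s≢t (All.map (decidable-stable (c _ ≟ c t)) (¬Any⇒All¬ _ none)))

    beyond-recoloured : ∀ {x y a₀} → Beyond x y a₀ → ∃[ a ] Beyond x y a × c a ≢ c x
    beyond-recoloured {x} {a₀ = a₀} (a₀≢x , ¬a₀y) with cfc a₀ x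
    ... | w , path , cf with conflictFree⇒colour≢ w cf a₀≢x
    ...   | a , a∈ , ca≢cx =
      a , (a≢x , λ ay → ¬a₀y (avoiding-trans (path-prefix w path a∈ a≢x) ay)) , ca≢cx
      where
        a≢x : a ≢ x
        a≢x = ca≢cx ∘ cong c

    two-cutVertices⇒¬≤2 : ∀ {x y} → k ≤ 2 → x ≢ y → IsCutVertex G x → IsCutVertex G y → ⊥
    two-cutVertices⇒¬≤2 {x} {y} k≤2 x≢y cut-x cut-y =
      cutVertex-beyond y cut-x λ (_ , a₀) → cutVertex-beyond x cut-y λ (_ , b₀) →
      separate (beyond-recoloured a₀) (beyond-recoloured b₀)
      where
        separate : (∃[ a ] Beyond x y a × c a ≢ c x) → (∃[ b ] Beyond y x b × c b ≢ c y) → ⊥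
        separate (a , ba@(a≢x , ¬ay) , ca≢cx) (b , bb@(b≢y , ¬bx) , cb≢cy) with cfc a b
        ... | w , _ , (i , once) = twice (Fin≤2-cover k≤2 i ca≢cx) (Fin≤2-cover k≤2 i cb≢cy)
          where
            a∈ = source∈ w
            b∈ = target∈ w
            x∈ = must-visit (beyond-separated x≢y ba bb) w
            y∈ = must-visit (beyond-separated (≢-sym x≢y) bb ba ∘ avoiding-sym) w
            a≢b : a ≢ b
            a≢b refl = beyond-separated x≢y ba bb ([ a ] , a≢x ∷ [])
            a≢y : a ≢ y
            a≢y refl = ¬ay ([ a ] , a≢x ∷ [])
            x≢b : x ≢ b
            x≢b refl = ¬bx ([ x ] , x≢y ∷ [])
            twice : i ≡ c a ⊎ i ≡ c x → i ≡ c b ⊎ i ≡ c y → ⊥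
            twice (inj₁ ia) (inj₁ ib) = once⇒¬twice _ once a∈ b∈ a≢b (sym ia) (sym ib)
            twice (inj₁ ia) (inj₂ iy) = once⇒¬twice _ once a∈ y∈ a≢y (sym ia) (sym iy)
            twice (inj₂ ix) (inj₁ ib) = once⇒¬twice _ once x∈ b∈ x≢b (sym ix) (sym ib)
            twice (inj₂ ix) (inj₂ iy) = once⇒¬twice _ once x∈ y∈ x≢y (sym ix) (sym iy)

    two-cutVertices⇒3≤colours : ∀ {x y} → x ≢ y → IsCutVertex G x → IsCutVertex G y → 3 ≤ k
    two-cutVertices⇒3≤colours x≢y cut-x cut-y with 3 ≤? k
    ... | yes 3≤k = 3≤k
    ... | no 3≰k = ⊥-elim (two-cutVertices⇒¬≤2 (≤-pred (≰⇒> 3≰k)) x≢y cut-x cut-y)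

maxDegree-attained : ∀ {n} (G : Graph n) → Fin n → ∃[ v ] maxDegree G ≤ degree G v
maxDegree-attained {suc _} G _ = foldr-⊔-attained (degree G) zero (tabulate suc)

module _ {n : ℕ} (G : Graph n) where

  record NonNeighbourEnumeration (v : Fin n) (m : ℕ) : Set where
    field
      nonNbr : Fin m → Fin n
      nonNbr-injective : ∀ {i j} → nonNbr i ≡ nonNbr j → i ≡ j
      nonNbr≢ : ∀ i → nonNbr i ≢ v
      nonNbr-nonadjacent : ∀ i → Adj G v (nonNbr i) ≡ false
      nonNbr-complete : ∀ {u} → u ≢ v → Adj G v u ≡ false → ∃[ i ] nonNbr i ≡ u

  module _ (v : Fin n) where

    private
      NonNbr : Fin n → Set
      NonNbr u = Adj G v u ≡ false × u ≢ v

      nonNbr? : Decidable NonNbr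
      nonNbr? u = (Adj G v u Boolₚ.≟ false) ×-dec ¬? (u ≟ v)

    nonNeighbours : List (Fin n)
    nonNeighbours = filter nonNbr? (allFin n)

    degree+nonNeighbours< : degree G v + length nonNeighbours < n
    degree+nonNeighbours< = subst (degree G v + length nonNeighbours <_) (length-tabulate id)
      (length-filter-disjoint-< (λ u → Adj G v u Boolₚ.≟ true) nonNbr? (λ vu (¬vu , _) → Boolₚ.not-¬ vu ¬vu)
        (allFin n) (∈-allFin v) (Boolₚ.not-¬ (irrefl G v)) (λ (_ , v≢v) → v≢v refl))

    enumerate-nonNeighbours : NonNeighbourEnumeration v (length nonNeighbours)
    enumerate-nonNeighbours = record
      { nonNbr = List.lookup nonNeighbours
      ; nonNbr-injective = lookup-injective nonNeighbours (filter⁺ nonNbr? (allFin⁺ n))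
      ; nonNbr≢ = λ i → proj₂ (nonNbr-spec i)
      ; nonNbr-nonadjacent = λ i → proj₁ (nonNbr-spec i)
      ; nonNbr-complete = λ u≢v ¬vu →
          let u∈ = ∈-filter⁺ nonNbr? (∈-allFin _) (¬vu , u≢v) in index u∈ , sym (lookup-index u∈)
      }
      where
        nonNbr-spec : ∀ i → NonNbr (List.lookup nonNeighbours i)
        nonNbr-spec i = proj₂ (∈-filter⁻ nonNbr? {xs = allFin n} (∈-lookup i))

  few-nonNeighbours : Fin n → n ≤ maxDegree G + 4 → ∃[ v ] ∃[ m ] m ≤ 3 × NonNeighbourEnumeration v m
  few-nonNeighbours x n≤Δ+4 with maxDegree-attained G x
  ... | v , Δ≤deg = v , length (nonNeighbours v) , m≤3 , enumerate-nonNeighbours v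
    where
      open ≤-Reasoning
      d = degree G v
      m = length (nonNeighbours v)
      m≤3 : m ≤ 3
      m≤3 = ≤-pred (+-cancelˡ-≤ d (suc m) 4 (begin
        d + suc m       ≡⟨ +-suc d m ⟩
        suc (d + m)     ≤⟨ degree+nonNeighbours< v ⟩
        n               ≤⟨ n≤Δ+4 ⟩
        maxDegree G + 4 ≤⟨ +-monoˡ-≤ 4 Δ≤deg ⟩
        d + 4           ∎))

module Model where

  -- A vertex v of maximum degree with m non-neighbours is modelled by the centre, a hub for each
  -- non-neighbour at distance 2 (a common neighbour with v), the non-neighbours themselves (far),
  -- and one node standing for any other neighbour of v.  A shape gives the tree parent of each
  -- far node; hub j is used only if far j has it as parent.
  data Parent (m : ℕ) : Set where
    viaHub viaFar : Fin m → Parent m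

  data Node (m : ℕ) : Set where
    centre : Node m
    hub far : Fin m → Node m
    other : Node m

  Shape : ℕ → Set
  Shape m = Vec (Parent m) m

  Colour : Set
  Colour = Fin 3

  module _ {m : ℕ} where

    _≟ᴾ_ : DecidableEquality (Parent m)
    viaHub i ≟ᴾ viaHub j = map′ (cong viaHub) (λ { refl → refl }) (i ≟ j)
    viaFar i ≟ᴾ viaFar j = map′ (cong viaFar) (λ { refl → refl }) (i ≟ j)
    viaHub _ ≟ᴾ viaFar _ = no λ ()
    viaFar _ ≟ᴾ viaHub _ = no λ ()

    _≟ᴺ_ : DecidableEquality (Node m)
    centre ≟ᴺ centre = yes refl
    hub i ≟ᴺ hub j = map′ (cong hub) (λ { refl → refl }) (i ≟ j)
    far i ≟ᴺ far j = map′ (cong far) (λ { refl → refl }) (i ≟ j)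
    other ≟ᴺ other = yes refl
    centre ≟ᴺ hub _ = no λ ()
    centre ≟ᴺ far _ = no λ ()
    centre ≟ᴺ other = no λ ()
    hub _ ≟ᴺ centre = no λ ()
    hub _ ≟ᴺ far _ = no λ ()
    hub _ ≟ᴺ other = no λ ()
    far _ ≟ᴺ centre = no λ ()
    far _ ≟ᴺ hub _ = no λ ()
    far _ ≟ᴺ other = no λ ()
    other ≟ᴺ centre = no λ ()
    other ≟ᴺ hub _ = no λ ()
    other ≟ᴺ far _ = no λ ()

    open import Data.List.Membership.DecPropositional _≟ᴺ_ using (_∈?_)

    parentNode : Parent m → Node m
    parentNode (viaHub j) = hub j
    parentNode (viaFar k) = far k

    up : Shape m → Node m → Node m
    up sh (far i) = parentNode (lookup sh i)
    up sh _ = centre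

    ascend : Shape m → ℕ → Node m → Node m
    ascend sh zero a = a
    ascend sh (suc f) a = ascend sh f (up sh a)

    ascend-centre : ∀ sh f → ascend sh f centre ≡ centre
    ascend-centre sh zero = refl
    ascend-centre sh (suc f) = ascend-centre sh f

    ascend-mono : ∀ sh {f g a} → f ≤ g → ascend sh f a ≡ centre → ascend sh g a ≡ centre
    ascend-mono sh {g = g} z≤n refl = ascend-centre sh g
    ascend-mono sh (s≤s f≤g) reached = ascend-mono sh f≤g reached

    -- Trees of valid shapes have depth at most 4, so the fuel 5 below suffices.
    ancestors : Shape m → ℕ → Node m → List (Node m)
    ancestors sh _ centre = centre ∷ []
    ancestors sh zero a = a ∷ []
    ancestors sh (suc f) a = a ∷ ancestors sh f (up sh a)

    depth : Shape m → Node m → ℕ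
    depth sh a = pred (length (ancestors sh 5 a))

    treeRoute : Shape m → Node m → Node m → List (Node m)
    treeRoute sh a b = below as ++ l ∷ reverse (below bs)
      where
        as = ancestors sh 5 a
        bs = ancestors sh 5 b
        l = fromMaybe centre (head (filter (_∈? bs) as))
        below = takeWhile (λ x → ¬? (x ≟ᴺ l))

    -- No single colour for depth 3 works for every shape, hence the flag.
    colour : Bool → Shape m → Node m → Colour
    colour flag sh (far i) with depth sh (far i)
    ... | 2 = suc (suc zero)
    ... | 3 = if flag then zero else suc zero
    ... | _ = zero
    colour flag sh centre = zero
    colour flag sh _ = suc zero

    occurrences : (Node m → Colour) → Colour → List (Node m) → ℕ
    occurrences c i xs = length (filter (λ x → c x ≟ i) xs)

    Present : Shape m → Node m → Set
    Present sh (hub j) = lookup sh j ≡ viaHub j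
    Present sh _ = ⊤

    present? : (sh : Shape m) → ∀ a → Dec (Present sh a)
    present? sh (hub j) = lookup sh j ≟ᴾ viaHub j
    present? sh centre = yes tt
    present? sh (far _) = yes tt
    present? sh other = yes tt

    Edge : Shape m → Node m → Node m → Set
    Edge sh a b = a ≢ centre × up sh a ≡ b

    Adjacent : Shape m → Node m → Node m → Set
    Adjacent sh a b = Edge sh a b ⊎ Edge sh b a

    adjacent? : (sh : Shape m) → ∀ a b → Dec (Adjacent sh a b)
    adjacent? sh a b = edge? a b ⊎-dec edge? b a
      where
        edge? : ∀ a b → Dec (Edge sh a b)
        edge? a b = ¬? (a ≟ᴺ centre) ×-dec (up sh a ≟ᴺ b)

    Chain : Shape m → Node m → List (Node m) → Set
    Chain sh a [] = ⊤
    Chain sh a (b ∷ R) = Adjacent sh a b × Chain sh b R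

    chain? : (sh : Shape m) → ∀ a R → Dec (Chain sh a R)
    chain? sh a [] = yes tt
    chain? sh a (b ∷ R) = adjacent? sh a b ×-dec chain? sh b R

    endpoint : Node m → List (Node m) → Node m
    endpoint a [] = a
    endpoint a (b ∷ R) = endpoint b R

    record Route (flag : Bool) (sh : Shape m) (a b : Node m) (R : List (Node m)) : Set where
      field
        chain : Chain sh a R
        ends : endpoint a R ≡ b
        unique : Unique (a ∷ R)
        present : All (Present sh) (a ∷ R)
        conflictFree : ∃[ i ] occurrences (colour flag sh) i (a ∷ R) ≡ 1
        other-at-end : other ∈ a ∷ R → a ≡ other ⊎ b ≡ other

    route? : ∀ flag sh a b R → Dec (Route flag sh a b R)
    route? flag sh a b R =
      map′ (λ (c , e , u , p , f , o) → record
              { chain = c ; ends = e ; unique = u ; present = p ; conflictFree = f ; other-at-end = o })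
           (λ r → let open Route r in chain , ends , unique , present , conflictFree , other-at-end)
           (chain? sh a R ×-dec endpoint a R ≟ᴺ b ×-dec allPairs? (λ x y → ¬? (x ≟ᴺ y)) (a ∷ R)
             ×-dec All.all? (present? sh) (a ∷ R)
             ×-dec any? (λ i → occurrences (colour flag sh) i (a ∷ R) ℕₚ.≟ 1)
             ×-dec (other ∈? a ∷ R →-dec (a ≟ᴺ other ⊎-dec b ≟ᴺ other)))

    Relevant : Shape m → Node m → Node m → Set
    Relevant sh a b = Present sh a × Present sh b × a ≢ b × ¬ (a ≡ other × b ≡ other)

    relevant? : ∀ sh a b → Dec (Relevant sh a b)
    relevant? sh a b =
      present? sh a ×-dec present? sh b ×-dec ¬? (a ≟ᴺ b) ×-dec ¬? (a ≟ᴺ other ×-dec b ≟ᴺ other)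

    nodes : List (Node m)
    nodes = centre ∷ other ∷ map hub (allFin m) ++ map far (allFin m)

    ∈-nodes : ∀ a → a ∈ nodes
    ∈-nodes centre = here refl
    ∈-nodes other = there (here refl)
    ∈-nodes (hub j) = there (there (∈-++⁺ˡ (∈-map⁺ hub (∈-allFin j))))
    ∈-nodes (far i) = there (there (∈-++⁺ʳ (map hub (allFin m)) (∈-map⁺ far (∈-allFin i))))

    ∀-node? : {P : Node m → Set} → (∀ a → Dec (P a)) → Dec (∀ a → P a)
    ∀-node? P? =
      map′ (λ ps a → All.lookup ps (∈-nodes a)) (λ ps → All.tabulate λ {a} _ → ps a) (All.all? P? nodes)

    GoodShape : Bool → Shape m → Set
    GoodShape flag sh = ∀ a b → Relevant sh a b → Route flag sh a b (drop 1 (treeRoute sh a b))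

    goodShape? : ∀ flag sh → Dec (GoodShape flag sh)
    goodShape? flag sh = ∀-node? λ a → ∀-node? λ b → relevant? sh a b →-dec route? flag sh a b _

    flag : Shape m → Bool
    flag sh = does (¬? (goodShape? false sh))

    ValidParent : Shape m → Parent m → Set
    ValidParent sh (viaHub j) = lookup sh j ≡ viaHub j
    ValidParent sh (viaFar _) = ⊤

    Valid : Shape m → Set
    Valid sh = ∀ i → ValidParent sh (lookup sh i) × ascend sh 4 (far i) ≡ centre

    valid? : ∀ sh → Dec (Valid sh)
    valid? sh = all? λ i → validParent? (lookup sh i) ×-dec ascend sh 4 (far i) ≟ᴺ centre
      where
        validParent? : ∀ p → Dec (ValidParent sh p)
        validParent? (viaHub j) = lookup sh j ≟ᴾ viaHub j
        validParent? (viaFar _) = yes tt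

  vectors : ∀ {A : Set} → List A → (k : ℕ) → List (Vec A k)
  vectors xs zero = [] ∷ []
  vectors xs (suc k) = cartesianProductWith _∷_ xs (vectors xs k)

  ∈-vectors : ∀ {A : Set} {xs : List A} → (∀ x → x ∈ xs) → ∀ {k} (v : Vec A k) → v ∈ vectors xs k
  ∈-vectors all∈ [] = here refl
  ∈-vectors all∈ (x ∷ v) = ∈-cartesianProductWith⁺ _∷_ (all∈ x) (∈-vectors all∈ v)

  parents : (m : ℕ) → List (Parent m)
  parents m = map viaHub (allFin m) ++ map viaFar (allFin m)

  ∈-parents : ∀ {m} (p : Parent m) → p ∈ parents m
  ∈-parents {m} (viaHub j) = ∈-++⁺ˡ (∈-map⁺ viaHub (∈-allFin j))
  ∈-parents {m} (viaFar k) = ∈-++⁺ʳ (map viaHub (allFin m)) (∈-map⁺ viaFar (∈-allFin k))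

  shapesChecked : (m : ℕ) → Dec (All (λ sh → Valid sh → GoodShape (flag sh) sh) (vectors (parents m) m))
  shapesChecked m = All.all? (λ sh → valid? sh →-dec goodShape? (flag sh) sh) (vectors (parents m) m)

  valid⇒good : ∀ {m} → m ≤ 3 → (sh : Shape m) → Valid sh → ∃[ flag ] GoodShape flag sh
  valid⇒good {m} m≤3 sh valid = flag sh , All.lookup (checked m≤3) (∈-vectors ∈-parents sh) valid
    where
      checked : ∀ {m} → m ≤ 3 → All (λ sh → Valid sh → GoodShape (flag sh) sh) (vectors (parents m) m)
      checked {0} _ = toWitness {a? = shapesChecked 0} tt
      checked {1} _ = toWitness {a? = shapesChecked 1} tt
      checked {2} _ = toWitness {a? = shapesChecked 2} tt
      checked {3} _ = toWitness {a? = shapesChecked 3} tt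
      checked {suc (suc (suc (suc _)))} (s≤s (s≤s (s≤s ())))

module BreadthFirstShape {n : ℕ} (G : Graph n) (connected : Connected G) {v : Fin n} {m : ℕ}
                         (E : NonNeighbourEnumeration G v m) (m≤3 : m ≤ 3) where

  open WalkProperties G
  open NonNeighbourEnumeration E
  open Model

  adj? : ∀ a b → Dec (Adj G a b ≡ true)
  adj? a b = Adj G a b Boolₚ.≟ true

  ¬adj-centre : ∀ i → ¬ Adj G v (nonNbr i) ≡ true
  ¬adj-centre i vi = Boolₚ.not-¬ vi (nonNbr-nonadjacent i)

  ¬adj-self : ∀ {x} → ¬ Adj G x x ≡ true
  ¬adj-self {x} xx = Boolₚ.not-¬ xx (irrefl G x)

  CommonNeighbour : Fin m → Fin n → Set
  CommonNeighbour i u = Adj G (nonNbr i) u ≡ true × Adj G v u ≡ true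

  Layer2 Layer3 Layer4 : Fin m → Set
  Layer2 i = ∃ (CommonNeighbour i)
  Layer3 i = ¬ Layer2 i × ∃[ k ] Layer2 k × Adj G (nonNbr i) (nonNbr k) ≡ true
  Layer4 i = ¬ Layer2 i × ¬ Layer3 i × ∃[ k ] Layer3 k × Adj G (nonNbr i) (nonNbr k) ≡ true

  layer2? : Decidable Layer2
  layer2? i = any? λ u → adj? (nonNbr i) u ×-dec adj? v u

  layer3? : Decidable Layer3
  layer3? i = ¬? (layer2? i) ×-dec any? λ k → layer2? k ×-dec adj? (nonNbr i) (nonNbr k)

  layer4? : Decidable Layer4
  layer4? i = ¬? (layer2? i) ×-dec ¬? (layer3? i) ×-dec any? λ k → layer3? k ×-dec adj? (nonNbr i) (nonNbr k)

  Unlayered : Fin n → Set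
  Unlayered z = ∃[ i ] nonNbr i ≡ z × ¬ Layer2 i × ¬ Layer3 i × ¬ Layer4 i

  -- A neighbour of an unlayered vertex is unlayered: otherwise it lies in layer 4,
  -- and together with its layer-3 and layer-2 ancestors gives four non-neighbours of v.
  unlayered-closed : ∀ {z z′} → Unlayered z → Adj G z z′ ≡ true → Unlayered z′
  unlayered-closed {z′ = z′} (k , refl , ¬2 , ¬3 , ¬4) adj with z′ ≟ v | adj? v z′
  ... | yes refl | _ = contradiction (adj-sym adj) (¬adj-centre k)
  ... | no _ | yes vz′ = contradiction (z′ , adj , vz′) ¬2
  ... | no z′≢v | no ¬vz′ with nonNbr-complete z′≢v (Boolₚ.¬-not ¬vz′)
  ...   | k′ , refl = k′ , refl , ¬2′ , ¬3′ , ¬4′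
    where
      ¬2′ : ¬ Layer2 k′
      ¬2′ l2 = ¬3 (¬2 , k′ , l2 , adj)
      ¬3′ : ¬ Layer3 k′
      ¬3′ l3 = ¬4 (¬2 , ¬3 , k′ , l3 , adj)
      ¬4′ : ¬ Layer4 k′
      ¬4′ l4@(¬2k′ , ¬3k′ , p , l3p@(¬2p , q , l2q , _) , _) =
        contradiction (≤-trans (unique⇒length≤ (k ∷ k′ ∷ p ∷ q ∷ []) distinct) m≤3) λ { (s≤s (s≤s (s≤s ()))) }
        where
          distinct : Unique (k ∷ k′ ∷ p ∷ q ∷ [])
          distinct = ((λ { refl → ¬4 l4 }) ∷ (λ { refl → ¬3 l3p }) ∷ (λ { refl → ¬2 l2q }) ∷ [])
                   ∷ ((λ { refl → ¬3k′ l3p }) ∷ (λ { refl → ¬2k′ l2q }) ∷ [])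
                   ∷ ((λ { refl → ¬2p l2q }) ∷ []) ∷ [] ∷ []

  every-layered : ∀ i → Layer2 i ⊎ Layer3 i ⊎ Layer4 i
  every-layered i with layer2? i | layer3? i | layer4? i
  ... | yes l2 | _ | _ = inj₁ l2
  ... | no _ | yes l3 | _ = inj₂ (inj₁ l3)
  ... | no _ | no _ | yes l4 = inj₂ (inj₂ l4)
  ... | no ¬2 | no ¬3 | no ¬4
    with closed-along-walk unlayered-closed (connected (nonNbr i) v) (i , refl , ¬2 , ¬3 , ¬4)
  ...   | k , k≡v , _ = contradiction k≡v (nonNbr≢ k)

  hubOf : Fin m → Fin n
  hubOf i with layer2? i
  ... | yes (u , _) = u
  ... | no _ = v

  hubOf-common : ∀ {i} → Layer2 i → CommonNeighbour i (hubOf i)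
  hubOf-common {i} l2 with layer2? i
  ... | yes (_ , common) = common
  ... | no ¬2 = contradiction l2 ¬2

  SharesHub : Fin n → Fin m → Set
  SharesHub u j = Layer2 j × hubOf j ≡ u

  firstSharing : Fin n → Fin m → Fin m
  firstSharing u d with any? (λ j → layer2? j ×-dec hubOf j ≟ u)
  ... | yes (j , _) = j
  ... | no _ = d

  firstSharing-shares : ∀ {u i} d → SharesHub u i → SharesHub u (firstSharing u d)
  firstSharing-shares {u} {i} d shares with any? (λ j → layer2? j ×-dec hubOf j ≟ u)
  ... | yes (_ , shares′) = shares′
  ... | no none = contradiction (i , shares) none

  firstSharing-default : ∀ {u i} d d′ → SharesHub u i → firstSharing u d ≡ firstSharing u d′
  firstSharing-default {u} {i} d d′ shares with any? (λ j → layer2? j ×-dec hubOf j ≟ u)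
  ... | yes _ = refl
  ... | no none = contradiction (i , shares) none

  -- Layer-2 vertices with the same hub must point to a single hub node of the model.
  representative : Fin m → Fin m
  representative i = firstSharing (hubOf i) i

  representative-shares : ∀ {i} → Layer2 i → SharesHub (hubOf i) (representative i)
  representative-shares {i} l2 = firstSharing-shares i (l2 , refl)

  representative-cong : ∀ {i j} → Layer2 i → hubOf i ≡ hubOf j → representative i ≡ representative j
  representative-cong {i} {j} l2 eq rewrite eq = firstSharing-default i j (l2 , eq)

  representative-idem : ∀ {i} → Layer2 i → representative (representative i) ≡ representative i
  representative-idem l2 = let (l2′ , eq) = representative-shares l2 in representative-cong l2′ eq

  layer : Fin m → ℕ
  layer i with layer2? i | layer3? i
  ... | yes _ | _ = 2
  ... | no _ | yes _ = 3
  ... | no _ | no _ = 4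

  layer-2 : ∀ {i} → Layer2 i → layer i ≡ 2
  layer-2 {i} l2 with layer2? i
  ... | yes _ = refl
  ... | no ¬2 = contradiction l2 ¬2

  layer-3 : ∀ {i} → Layer3 i → layer i ≡ 3
  layer-3 {i} l3@(¬2 , _) with layer2? i | layer3? i
  ... | yes l2 | _ = contradiction l2 ¬2
  ... | no _ | yes _ = refl
  ... | no _ | no ¬3 = contradiction l3 ¬3

  layer-4 : ∀ {i} → Layer4 i → layer i ≡ 4
  layer-4 {i} (¬2 , ¬3 , _) with layer2? i | layer3? i
  ... | yes l2 | _ = contradiction l2 ¬2
  ... | no _ | yes l3 = contradiction l3 ¬3
  ... | no _ | no _ = refl

  2≤layer : ∀ i → 2 ≤ layer i
  2≤layer i with layer2? i | layer3? i
  ... | yes _ | _ = s≤s (s≤s z≤n)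
  ... | no _ | yes _ = s≤s (s≤s z≤n)
  ... | no _ | no _ = s≤s (s≤s z≤n)

  layer≤4 : ∀ i → layer i ≤ 4
  layer≤4 i with layer2? i | layer3? i
  ... | yes _ | _ = s≤s (s≤s z≤n)
  ... | no _ | yes _ = s≤s (s≤s (s≤s z≤n))
  ... | no _ | no _ = s≤s (s≤s (s≤s (s≤s z≤n)))

  parent : Fin m → Parent m
  parent i with layer2? i | layer3? i | layer4? i
  ... | yes _ | _ | _ = viaHub (representative i)
  ... | no _ | yes (_ , k , _) | _ = viaFar k
  ... | no _ | no _ | yes (_ , _ , k , _) = viaFar k
  ... | no _ | no _ | no _ = viaHub i  -- unreachable, by every-layered

  data ParentSpec (i : Fin m) : Parent m → Set where
    hub-parent : Layer2 i → ParentSpec i (viaHub (representative i))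
    far-parent : ∀ {k} → ¬ Layer2 i → Adj G (nonNbr i) (nonNbr k) ≡ true → suc (layer k) ≡ layer i →
                 ParentSpec i (viaFar k)

  parent-spec : ∀ i → ParentSpec i (parent i)
  parent-spec i with layer2? i | layer3? i | layer4? i | every-layered i
  ... | yes l2 | _ | _ | _ = hub-parent l2
  ... | no ¬2 | yes l3@(_ , k , l2k , adj) | _ | _ =
    far-parent ¬2 adj (trans (cong suc (layer-2 l2k)) (sym (layer-3 l3)))
  ... | no ¬2 | no _ | yes l4@(_ , _ , k , l3k , adj) | _ =
    far-parent ¬2 adj (trans (cong suc (layer-3 l3k)) (sym (layer-4 l4)))
  ... | no ¬2 | no ¬3 | no ¬4 | layered =
    contradiction layered λ { (inj₁ l2) → ¬2 l2 ; (inj₂ (inj₁ l3)) → ¬3 l3 ; (inj₂ (inj₂ l4)) → ¬4 l4 }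

  shape : Shape m
  shape = Vec.tabulate parent

  shape-spec : ∀ i → ParentSpec i (lookup shape i)
  shape-spec i = subst (ParentSpec i) (sym (lookup∘tabulate parent i)) (parent-spec i)

  lookup-layer2 : ∀ {j} → Layer2 j → lookup shape j ≡ viaHub (representative j)
  lookup-layer2 {j} l2 with lookup shape j | shape-spec j
  ... | _ | hub-parent _ = refl
  ... | _ | far-parent ¬2 _ _ = contradiction l2 ¬2

  present-hub : ∀ {j} → Present shape (hub j) → Layer2 j × representative j ≡ j
  present-hub {j} p with lookup shape j | shape-spec j
  ... | _ | hub-parent l2 = l2 , viaHub-injective p
    where
      viaHub-injective : ∀ {i j : Fin m} → viaHub i ≡ viaHub j → i ≡ j
      viaHub-injective refl = refl
  ... | _ | far-parent _ _ _ = contradiction p λ ()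

  hub-adjacent : ∀ {j} → Present shape (hub j) → Adj G v (hubOf j) ≡ true
  hub-adjacent p = proj₂ (hubOf-common (proj₁ (present-hub p)))

  ascend-layer : ∀ f i → layer i ≡ f → ascend shape f (far i) ≡ centre
  ascend-layer zero i layer≡0 = contradiction (subst (2 ≤_) layer≡0 (2≤layer i)) λ ()
  ascend-layer (suc f) i layer≡ with lookup shape i | shape-spec i
  ... | _ | hub-parent l2 with trans (sym layer≡) (layer-2 l2)
  ...   | refl = refl
  ascend-layer (suc f) i layer≡ | _ | far-parent {k} _ _ sk≡ = ascend-layer f k (suc-injective (trans sk≡ layer≡))

  valid-shape : Valid shape
  valid-shape i = valid-parent , ascend-mono shape (layer≤4 i) (ascend-layer (layer i) i refl)
    where
      valid-parent : ValidParent shape (lookup shape i)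
      valid-parent with lookup shape i | shape-spec i
      ... | _ | hub-parent l2 =
        trans (lookup-layer2 (proj₁ (representative-shares l2))) (cong viaHub (representative-idem l2))
      ... | _ | far-parent _ _ _ = tt

module Embedding {n : ℕ} (G : Graph n) (connected : Connected G) {v : Fin n} {m : ℕ}
                 (E : NonNeighbourEnumeration G v m) (m≤3 : m ≤ 3) where

  open WalkProperties G
  open NonNeighbourEnumeration E
  open Model
  open BreadthFirstShape G connected E m≤3

  data Role (x : Fin n) : Node m → Set where
    centre-role : x ≡ v → Role x centre
    far-role : ∀ {i} → nonNbr i ≡ x → Role x (far i)
    hub-role : ∀ {j} → Present shape (hub j) → hubOf j ≡ x → Role x (hub j)
    other-role : Adj G v x ≡ true → (∀ j → Present shape (hub j) → hubOf j ≢ x) → Role x other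

  classify : Fin n → Node m
  classify x with x ≟ v
  ... | yes _ = centre
  ... | no _ with any? (λ i → nonNbr i ≟ x)
  ...   | yes (i , _) = far i
  ...   | no _ with any? (λ j → present? shape (hub j) ×-dec hubOf j ≟ x)
  ...     | yes (j , _) = hub j
  ...     | no _ = other

  adjacent-unless-far : ∀ {x} → x ≢ v → ¬ ∃ (λ i → nonNbr i ≡ x) → Adj G v x ≡ true
  adjacent-unless-far {x} x≢v ¬far with Adj G v x in vx
  ... | true = refl
  ... | false = contradiction (nonNbr-complete x≢v vx) ¬far

  role : ∀ x → Role x (classify x)
  role x with x ≟ v
  ... | yes x≡v = centre-role x≡v
  ... | no x≢v with any? (λ i → nonNbr i ≟ x)
  ...   | yes (_ , eq) = far-role eq
  ...   | no ¬far with any? (λ j → present? shape (hub j) ×-dec hubOf j ≟ x)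
  ...     | yes (_ , p , eq) = hub-role p eq
  ...     | no ¬hub = other-role (adjacent-unless-far x≢v ¬far) λ j p eq → ¬hub (j , p , eq)

  role-present : ∀ {x a} → Role x a → Present shape a
  role-present (centre-role _) = tt
  role-present (far-role _) = tt
  role-present (hub-role p _) = p
  role-present (other-role _ _) = tt

  classify-centre : classify v ≡ centre
  classify-centre with v ≟ v
  ... | yes _ = refl
  ... | no v≢v = contradiction refl v≢v

  classify-far : ∀ i → classify (nonNbr i) ≡ far i
  classify-far i with nonNbr i ≟ v
  ... | yes eq = contradiction eq (nonNbr≢ i)
  ... | no _ with any? (λ i′ → nonNbr i′ ≟ nonNbr i)
  ...   | yes (_ , eq) = cong far (nonNbr-injective eq)
  ...   | no ¬far = contradiction (i , refl) ¬far

  classify-hub : ∀ {j} → Present shape (hub j) → classify (hubOf j) ≡ hub j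
  classify-hub {j} p with hubOf j ≟ v
  ... | yes eq = contradiction (subst (λ z → Adj G v z ≡ true) eq (hub-adjacent p)) ¬adj-self
  ... | no _ with any? (λ i → nonNbr i ≟ hubOf j)
  ...   | yes (i , eq) = contradiction (subst (λ z → Adj G v z ≡ true) (sym eq) (hub-adjacent p)) (¬adj-centre i)
  ...   | no _ with any? (λ j′ → present? shape (hub j′) ×-dec hubOf j′ ≟ hubOf j)
  ...     | yes (j′ , p′ , eq) = cong hub (begin
      j′                   ≡⟨ sym (proj₂ (present-hub p′)) ⟩
      representative j′    ≡⟨ representative-cong (proj₁ (present-hub p′)) eq ⟩
      representative j     ≡⟨ proj₂ (present-hub p) ⟩
      j                    ∎)
    where open ≡-Reasoning
  ...     | no ¬hub = contradiction (j , p , refl) ¬hub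

  classify-other : ∀ {x} → Adj G v x ≡ true → (∀ j → Present shape (hub j) → hubOf j ≢ x) →
                   classify x ≡ other
  classify-other {x} vx ¬hub′ with x ≟ v
  ... | yes refl = contradiction vx ¬adj-self
  ... | no _ with any? (λ i → nonNbr i ≟ x)
  ...   | yes (i , refl) = contradiction vx (¬adj-centre i)
  ...   | no _ with any? (λ j → present? shape (hub j) ×-dec hubOf j ≟ x)
  ...     | yes (j , p , eq) = contradiction eq (¬hub′ j p)
  ...     | no _ = refl

  classify-role : ∀ {x a} → Role x a → classify x ≡ a
  classify-role (centre-role refl) = classify-centre
  classify-role (far-role refl) = classify-far _
  classify-role (hub-role p refl) = classify-hub p
  classify-role (other-role vx ¬hub) = classify-other vx ¬hub

  -- The vertex u stands for the node other, which occurs in a route only as an endpoint.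
  embed : Fin n → Node m → Fin n
  embed u centre = v
  embed u (hub j) = hubOf j
  embed u (far i) = nonNbr i
  embed u other = u

  Embeddable : Fin n → Node m → Set
  Embeddable u a = Present shape a × (a ≡ other → Role u other)

  embed-role : ∀ {u x a} → Role x a → (a ≡ other → u ≡ x) → embed u a ≡ x
  embed-role (centre-role x≡v) _ = sym x≡v
  embed-role (far-role eq) _ = eq
  embed-role (hub-role _ eq) _ = eq
  embed-role (other-role _ _) u≡x = u≡x refl

  role-embed : ∀ {u a} → Embeddable u a → Role (embed u a) a
  role-embed {a = centre} _ = centre-role refl
  role-embed {a = hub j} (p , _) = hub-role p refl
  role-embed {a = far i} _ = far-role refl
  role-embed {a = other} (_ , u-other) = u-other refl

  classify-embed : ∀ {u a} → Embeddable u a → classify (embed u a) ≡ a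
  classify-embed = classify-role ∘ role-embed

  embed-up : ∀ {u a} → Embeddable u a → a ≢ centre → Adj G (embed u a) (embed u (up shape a)) ≡ true
  embed-up {a = centre} _ a≢centre = contradiction refl a≢centre
  embed-up {a = hub j} (p , _) _ = adj-sym (hub-adjacent p)
  embed-up {a = other} (_ , u-other) _ with u-other refl
  ... | other-role vu _ = adj-sym vu
  embed-up {a = far i} _ _ with lookup shape i | shape-spec i
  ... | _ | hub-parent l2 =
    subst (λ h → Adj G (nonNbr i) h ≡ true) (sym (proj₂ (representative-shares l2))) (proj₁ (hubOf-common l2))
  ... | _ | far-parent _ adj _ = adj

  embed-adjacent : ∀ {u a b} → Embeddable u a → Embeddable u b → Adjacent shape a b →
                   Adj G (embed u a) (embed u b) ≡ true
  embed-adjacent ea _ (inj₁ (a≢centre , refl)) = embed-up ea a≢centre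
  embed-adjacent _ eb (inj₂ (b≢centre , refl)) = adj-sym (embed-up eb b≢centre)

  lift : ∀ {u} a R → Chain shape a R → All (Embeddable u) (a ∷ R) →
         Σ (Walk G (embed u a) (embed u (endpoint a R))) λ w → vertices G w ≡ map (embed u) (a ∷ R)
  lift a [] _ _ = [ _ ] , refl
  lift a (b ∷ R) (ab , chain) (ea ∷ es) with lift b R chain es
  ... | w , vs = step (embed-adjacent ea (All.head es) ab) w , cong (_ ∷_) vs

  -- Opaque, so that the exhaustive check is never evaluated on this symbolic shape.
  opaque
    good-shape : ∃[ flag ] GoodShape flag shape
    good-shape = valid⇒good m≤3 shape valid-shape

  depth3-flag : Bool
  depth3-flag = proj₁ good-shape

  colouring : Fin n → Colour
  colouring = colour depth3-flag shape ∘ classify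

  embed-round-trip : ∀ {u L} → All (Embeddable u) L → map classify (map (embed u) L) ≡ L
  embed-round-trip {L = L} embeddable = trans (sym (map-∘ L)) (map-id-local (All.map classify-embed embeddable))

  unique-embed : ∀ {u L} → All (Embeddable u) L → Unique L → Unique (map (embed u) L)
  unique-embed embeddable unique = Unique.map⁻ (subst Unique (sym (embed-round-trip embeddable)) unique)

  countColour-embed : ∀ {u L} i → All (Embeddable u) L →
                      countColour G colouring i (map (embed u) L) ≡ occurrences (colour depth3-flag shape) i L
  countColour-embed {u} {L} i embeddable = begin
    countColour G colouring i (map (embed u) L)
      ≡⟨ length-filter-map (λ a → colour depth3-flag shape a ≟ i) classify (map (embed u) L) ⟩
    occurrences (colour depth3-flag shape) i (map classify (map (embed u) L))
      ≡⟨ cong (occurrences (colour depth3-flag shape) i) (embed-round-trip embeddable) ⟩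
    occurrences (colour depth3-flag shape) i L ∎
    where open ≡-Reasoning

  route-embeddable : ∀ {x y u R} → (classify x ≡ other → u ≡ x) → (classify y ≡ other → u ≡ y) →
                     Route depth3-flag shape (classify x) (classify y) R → All (Embeddable u) (classify x ∷ R)
  route-embeddable {x} {y} {u} u≡x u≡y route =
    All.tabulate λ a∈ → All.lookup present a∈ , λ { refl → u-other a∈ }
    where
      open Route route
      u-other : other ∈ _ → Role u other
      u-other o∈ with other-at-end o∈
      ... | inj₁ x-other = subst₂ Role (sym (u≡x x-other)) x-other (role x)
      ... | inj₂ y-other = subst₂ Role (sym (u≡y y-other)) y-other (role y)

  lift-route : ∀ {x y u} → (classify x ≡ other → u ≡ x) → (classify y ≡ other → u ≡ y) →
               ∀ R → Route depth3-flag shape (classify x) (classify y) R →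
               Σ (Walk G x y) λ w → IsPath G w × ConflictFree G colouring w
  lift-route {x} {y} {u} u≡x u≡y R route = w , path , i , once
    where
      open Route route
      embeddable = route-embeddable u≡x u≡y route
      lifted = lift (classify x) R chain embeddable
      cast = cast-walk (embed-role (role x) u≡x) (trans (cong (embed u) ends) (embed-role (role y) u≡y))
                       (proj₁ lifted)
      w = proj₁ cast
      vertices-w : vertices G w ≡ map (embed u) (classify x ∷ R)
      vertices-w = trans (proj₂ cast) (proj₂ lifted)
      path : IsPath G w
      path = subst Unique (sym vertices-w) (unique-embed embeddable unique)
      i = proj₁ conflictFree
      once : countColour G colouring i (vertices G w) ≡ 1
      once = trans (cong (countColour G colouring i) vertices-w)
                   (trans (countColour-embed i embeddable) (proj₂ conflictFree))

  classify-injective : ∀ {x y} → classify x ≡ classify y → classify x ≢ other → x ≡ y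
  classify-injective {x} {y} eq x-other = begin
    x                      ≡⟨ sym (embed-role (role x) λ _ → refl) ⟩
    embed x (classify x)   ≡⟨ cong (embed x) eq ⟩
    embed x (classify y)   ≡⟨ embed-role (role y) (λ y-other → contradiction (trans eq y-other) x-other) ⟩
    y                      ∎
    where open ≡-Reasoning

  conflictFree-route : ∀ {x y} → x ≢ y → ¬ (classify x ≡ other × classify y ≡ other) →
          Route depth3-flag shape (classify x) (classify y) (drop 1 (treeRoute shape (classify x) (classify y)))
  conflictFree-route {x} {y} x≢y not-both = proj₂ good-shape (classify x) (classify y)
    (role-present (role x) , role-present (role y) ,
     (λ eq → x≢y (classify-injective eq λ x-other → not-both (x-other , trans (sym eq) x-other))) , not-both)

  via-centre : ∀ {x y} → classify x ≡ other → classify y ≡ other → x ≢ y →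
               Σ (Walk G x y) λ w → IsPath G w × ConflictFree G colouring w
  via-centre {x} {y} x-other y-other x≢y with subst (Role x) x-other (role x) | subst (Role y) y-other (role y)
  ... | other-role vx _ | other-role vy _ =
    step (adj-sym vx) (step vy [ y ]) , ((x≢v ∷ x≢y ∷ []) ∷ (≢-sym y≢v ∷ []) ∷ [] ∷ []) , zero , once
    where
      x≢v : x ≢ v
      x≢v refl = ¬adj-self vx
      y≢v : y ≢ v
      y≢v refl = ¬adj-self vy
      P? = λ z → colouring z ≟ zero
      ¬zero : ∀ {z} → classify z ≡ other → colouring z ≢ zero
      ¬zero z-other eq = contradiction (trans (sym (cong (colour depth3-flag shape) z-other)) eq) λ ()
      once : countColour G colouring zero (x ∷ v ∷ y ∷ []) ≡ 1
      once = cong length (begin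
        filter P? (x ∷ v ∷ y ∷ [])  ≡⟨ filter-reject P? {x} (¬zero {x} x-other) ⟩
        filter P? (v ∷ y ∷ [])      ≡⟨ filter-accept P? {v} (cong (colour depth3-flag shape) classify-centre) ⟩
        v ∷ filter P? (y ∷ [])      ≡⟨ cong (v ∷_) (filter-reject P? {y} (¬zero {y} y-other)) ⟩
        v ∷ []                      ∎)
        where open ≡-Reasoning

  conflictFree-connected : CFVConnected G colouring
  conflictFree-connected x y with x ≟ y
  ... | yes refl =
    [ x ] , [] ∷ [] , colouring x , cong length (filter-accept (λ z → colouring z ≟ colouring x) {x} {[]} refl)
  ... | no x≢y with classify x ≟ᴺ other | classify y ≟ᴺ other
  ...   | yes x-other | yes y-other = via-centre x-other y-other x≢y
  ...   | yes x-other | no y-other =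
    lift-route (λ _ → refl) (λ y-other′ → contradiction y-other′ y-other) _
      (conflictFree-route x≢y λ (_ , y-other′) → y-other y-other′)
  ...   | no x-other | _ =
    lift-route (λ x-other′ → contradiction x-other′ x-other) (λ _ → refl) _
      (conflictFree-route x≢y λ (x-other′ , _) → x-other x-other′)

three-colours-suffice : ∀ {n} (G : Graph n) → Connected G → Fin n → n ≤ maxDegree G + 4 →
                        Σ (Fin n → Fin 3) (CFVConnected G)
three-colours-suffice G connected x n≤Δ+4 with few-nonNeighbours G x n≤Δ+4
... | _ , _ , m≤3 , E = _ , Embedding.conflictFree-connected G connected E m≤3

theorem3 : ∀ (n : ℕ) (G : Graph n) → Connected G
    → (∃[ v₁ ] ∃[ v₂ ] (v₁ ≢ v₂ × IsCutVertex G v₁ × IsCutVertex G v₂))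
    → n ≤ maxDegree G + 4
    → maxDegree G + 2 ≤ n
    → VcfcIs G 3
theorem3 n G connected (v₁ , v₂ , v₁≢v₂ , cut₁ , cut₂) n≤Δ+4 _ =
  three-colours-suffice G connected v₁ n≤Δ+4 ,
  λ k c cfc → LowerBound.two-cutVertices⇒3≤colours G connected c cfc v₁≢v₂ cut₁ cut₂
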